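{- Let $T$ be a finite set, and let $a_t$ be an integer for every $t\in T$. Let $S$ be a finite holey subset of $\mathbb{Z}$ such that $\sum_{t\in T} f_{n+a_t}=\sum_{s\in S} f_{n+s}$ for every $n\in\mathbb{Z}$ satisfying $n>\max\left(\{ -a_t\mid t\in T\}\cup\{ -s\mid s\in S\}\right)$. Let $S'$ be a finite holey subset of $\mathbb{Z}$ such that $\sum_{t\in T} f_{n+a_t}=\sum_{s\in S'} f_{n+s}$ for every $n\in\mathbb{Z}$ satisfying $n>\max\left(\{ -a_t\mid t\in T\}\cup\{ -s\mid s\in S'\}\right)$. Then $S=S'$.
   Context: A subset $S$ of $\mathbb{Z}$ is called holey if $s+1\notin S$ for every $s\in S$ (i.e., no two elements of $S$ are consecutive integers). $(f_1,f_2,f_3,\dots)$ denotes the Fibonacci sequence, defined by $f_1=f_2=1$ and $f_n=f_{n-1}+f_{n-2}$ for all integers $n\ge 3$; $f_m$ is only defined for positive integers $m$. -}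

module Defs where

open import Data.Nat using (ℕ; zero; suc; _+_)
open import Data.Integer using (ℤ; +_; -[1+_]) renaming (_+_ to _+ℤ_)
open import Data.List using (List)
open import Data.List.Membership.Propositional using (_∈_; _∉_)

-- Fibonacci on ℕ with fib 0 = 0, fib 1 = 1, so fib m = f_m for m ≥ 1.
fib : ℕ → ℕ
fib zero = zero
fib (suc zero) = 1
fib (suc (suc n)) = fib (suc n) + fib n

-- f_m for an integer index m; only ever used for m ≥ 1 (guaranteed by the
-- hypotheses of the statement), the value at m ≤ 0 is an irrelevant junk value.
f : ℤ → ℕ
f (+ n) = fib n
f -[1+ n ] = 0

-- A finite subset of ℤ is represented by a duplicate-free list.
-- Holey: no two elements are consecutive integers.
Holey : List ℤ → Set
Holey S = ∀ s → s ∈ S → (s +ℤ + 1) ∉ S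

module Submission where

-- The theorem is a disguised form of the uniqueness of Zeckendorf
-- representations.  Choose one integer N so large that N + a t ≥ 1 for all t
-- and N + s ≥ 2 for all s ∈ S ∪ S′.  Evaluating both hypotheses at this N gives
--   Σ_{s ∈ S} f (N + s) = Σ_t f (N + a t) = Σ_{s ∈ S′} f (N + s),
-- and the translates N + S and N + S′ are again duplicate-free and holey, now
-- consisting of integers ≥ 2.  By Zeckendorf's uniqueness theorem they are
-- equal, hence so are S and S′.

open import Defs
open import Data.Nat using (ℕ)
open import Data.Fin using (Fin)
open import Data.Integer using (ℤ; +_; _<_; _+_)
open import Data.List using (List; map; allFin)
open import Data.Nat.ListAction using (sum)
open import Data.List.Membership.Propositional using (_∈_)
open import Data.List.Relation.Unary.Unique.Propositional using (Unique)
open import Relation.Binary.PropositionalEquality using (_≡_)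
open import Function.Bundles using (_⇔_)

open import Algebra.Bundles using (AbelianGroup)
open import Data.Nat as ℕ using (zero; suc; z≤n; s≤s)
import Data.Nat.Properties as ℕ
open import Data.Nat.Solver using (module +-*-Solver)
open import Data.Integer as ℤ using (-[1+_]; ∣_∣; +<+)
import Data.Integer.Properties as ℤ
open import Data.List using ([]; _∷_; _++_)
open import Data.List.Properties using (map-∘)
open import Data.List.Relation.Unary.Any using (here; there)
import Data.List.Relation.Unary.All as All
open import Data.List.Relation.Unary.AllPairs using (_∷_)
open import Data.List.Membership.Propositional using (_∉_)
open import Data.List.Membership.Propositional.Properties
  using (∈-map⁺; ∈-map⁻; ∈-allFin; ∈-++⁺ˡ; ∈-++⁺ʳ)
open import Data.List.Membership.DecPropositional ℤ._≟_ using (_∈?_)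
import Data.List.Relation.Unary.Unique.Propositional.Properties as Unique
open import Data.Product using (_,_)
open import Data.Sum using (_⊎_; inj₁; inj₂)
open import Data.Empty using (⊥-elim)
open import Relation.Nullary using (yes; no)
open import Relation.Binary.PropositionalEquality
  using (refl; sym; trans; cong; cong₂; subst; _≢_; module ≡-Reasoning)
open import Function.Bundles using (mk⇔)
open import Function.Base using (_∘_)
open import Algebra.Properties.Group (AbelianGroup.group ℤ.+-0-abelianGroup)
  using () renaming (∙-cancelˡ to +-cancelˡ)

value : (ℕ → ℕ) → ℕ → ℕ
value c zero    = 0
value c (suc B) = value c B ℕ.+ c B ℕ.* fib B

value-digit0 : ∀ c B → c B ≡ 0 → value c (suc B) ≡ value c B
value-digit0 c B cB≡0 rewrite cB≡0 = ℕ.+-identityʳ (value c B)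

value-digit1 : ∀ c B → c B ≡ 1 → value c (suc B) ≡ value c B ℕ.+ fib B
value-digit1 c B cB≡1 rewrite cB≡1 = cong (value c B ℕ.+_) (ℕ.*-identityˡ (fib B))

value-vanishing : ∀ {c} B → (∀ i → i ℕ.< B → c i ≡ 0) → value c B ≡ 0
value-vanishing zero    _     = refl
value-vanishing (suc B) zeros =
  trans (value-digit0 _ B (zeros B ℕ.≤-refl))
        (value-vanishing B (λ i i<B → zeros i (ℕ.m<n⇒m<1+n i<B)))

value-+ : ∀ c d B → value (λ i → c i ℕ.+ d i) B ≡ value c B ℕ.+ value d B
value-+ c d zero    = refl
value-+ c d (suc B) rewrite value-+ c d B = regroup (value c B) (value d B) (c B) (d B) (fib B)
  where
  open +-*-Solver
  regroup : ∀ u v x y z → u ℕ.+ v ℕ.+ (x ℕ.+ y) ℕ.* z ≡ u ℕ.+ x ℕ.* z ℕ.+ (v ℕ.+ y ℕ.* z)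
  regroup = solve 5 (λ u v x y z → u :+ v :+ (x :+ y) :* z := u :+ x :* z :+ (v :+ y :* z)) refl

-- Zeckendorf digit sequences: digits 0 or 1, no ones at positions 0 and 1
-- (fib 0 = 0 and fib 1 = fib 2 would make those positions ambiguous), and no
-- two adjacent ones.
record Zeckendorf (c : ℕ → ℕ) : Set where
  field
    binary   : ∀ i → c i ≡ 0 ⊎ c i ≡ 1
    digit₀   : c 0 ≡ 0
    digit₁   : c 1 ≡ 0
    isolated : ∀ i → c i ≡ 1 → c (suc i) ≡ 0

open Zeckendorf

preceded-by-zero : ∀ {c} → Zeckendorf c → ∀ i → c (suc i) ≡ 1 → c i ≡ 0
preceded-by-zero zc i next≡1 with binary zc i
... | inj₁ ci≡0 = ci≡0
... | inj₂ ci≡1 with trans (sym next≡1) (isolated zc i ci≡1)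
...   | ()

-- The inductive step of the classical bound: if the sums over the digits below
-- B + 1 and below B + 2 stay under the corresponding Fibonacci numbers, so does
-- the sum over the digits below B + 3.  A top digit one forces the digit below
-- it to vanish, and fib (B + 1) + fib (B + 2) = fib (B + 3).
value-<-step : ∀ {c} → Zeckendorf c → ∀ B →
  value c (1 ℕ.+ B) ℕ.< fib (1 ℕ.+ B) → value c (2 ℕ.+ B) ℕ.< fib (2 ℕ.+ B) →
  value c (3 ℕ.+ B) ℕ.< fib (3 ℕ.+ B)
value-<-step {c} zc B bound₁ bound₂ with binary zc (2 ℕ.+ B)
... | inj₁ top≡0 = begin-strict
  value c (3 ℕ.+ B)      ≡⟨ value-digit0 c (2 ℕ.+ B) top≡0 ⟩
  value c (2 ℕ.+ B)      <⟨ bound₂ ⟩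
  fib (2 ℕ.+ B)          ≤⟨ ℕ.m≤m+n (fib (2 ℕ.+ B)) (fib (1 ℕ.+ B)) ⟩
  fib (3 ℕ.+ B)          ∎
  where open ℕ.≤-Reasoning
... | inj₂ top≡1 = begin-strict
  value c (3 ℕ.+ B)                      ≡⟨ value-digit1 c (2 ℕ.+ B) top≡1 ⟩
  value c (2 ℕ.+ B) ℕ.+ fib (2 ℕ.+ B)    ≡⟨ cong (ℕ._+ fib (2 ℕ.+ B)) below ⟩
  value c (1 ℕ.+ B) ℕ.+ fib (2 ℕ.+ B)    <⟨ ℕ.+-monoˡ-< (fib (2 ℕ.+ B)) bound₁ ⟩
  fib (1 ℕ.+ B) ℕ.+ fib (2 ℕ.+ B)        ≡⟨ ℕ.+-comm (fib (1 ℕ.+ B)) (fib (2 ℕ.+ B)) ⟩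
  fib (3 ℕ.+ B)                          ∎
  where
  open ℕ.≤-Reasoning
  below : value c (2 ℕ.+ B) ≡ value c (1 ℕ.+ B)
  below = value-digit0 c (1 ℕ.+ B) (preceded-by-zero zc (suc B) top≡1)

value-< : ∀ {c} → Zeckendorf c → ∀ B → value c (suc B) ℕ.< fib (suc B)
value-< {c} zc zero rewrite ℕ.*-zeroʳ (c 0) = s≤s z≤n
value-< {c} zc (suc zero) rewrite digit₁ zc | ℕ.*-zeroʳ (c 0) = s≤s z≤n
value-< zc (suc (suc B)) = value-<-step zc B (value-< zc B) (value-< zc (suc B))

-- Two Zeckendorf sequences with equal values cannot differ in the top digit:
-- a one there already outweighs all lower digits of the other sequence.
top-mismatch : ∀ {c d m} → Zeckendorf c → Zeckendorf d →
  c m ≡ 1 → d m ≡ 0 → value c (suc m) ≢ value d (suc m)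
top-mismatch {m = zero} zc zd cm≡1 _ _ with trans (sym (digit₀ zc)) cm≡1
... | ()
top-mismatch {c} {d} {suc m} zc zd cm≡1 dm≡0 same = ℕ.n≮n (fib (suc m)) (begin-strict
  fib (suc m)                          ≤⟨ ℕ.m≤n+m (fib (suc m)) (value c (suc m)) ⟩
  value c (suc m) ℕ.+ fib (suc m)      ≡⟨ sym (value-digit1 c (suc m) cm≡1) ⟩
  value c (2 ℕ.+ m)                    ≡⟨ same ⟩
  value d (2 ℕ.+ m)                    ≡⟨ value-digit0 d (suc m) dm≡0 ⟩
  value d (suc m)                      <⟨ value-< zd m ⟩
  fib (suc m)                          ∎)
  where open ℕ.≤-Reasoning

top-digit : ∀ {c d m} → Zeckendorf c → Zeckendorf d →
  value c (suc m) ≡ value d (suc m) → c m ≡ d m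
top-digit {m = m} zc zd same with binary zc m | binary zd m
... | inj₁ cm≡0 | inj₁ dm≡0 = trans cm≡0 (sym dm≡0)
... | inj₂ cm≡1 | inj₂ dm≡1 = trans cm≡1 (sym dm≡1)
... | inj₂ cm≡1 | inj₁ dm≡0 = ⊥-elim (top-mismatch zc zd cm≡1 dm≡0 same)
... | inj₁ cm≡0 | inj₂ dm≡1 = ⊥-elim (top-mismatch zd zc dm≡1 cm≡0 (sym same))

-- Uniqueness of Zeckendorf representations: equal values force equal digits.
-- Peel off the (equal) top digit, cancel it, and recurse.
zeckendorf-digits : ∀ {c d} → Zeckendorf c → Zeckendorf d →
  ∀ B → value c B ≡ value d B → ∀ i → i ℕ.< B → c i ≡ d i
zeckendorf-digits {c} {d} zc zd (suc m) same i i<1+m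
  with ℕ.m≤n⇒m<n∨m≡n (ℕ.s≤s⁻¹ i<1+m)
... | inj₂ refl = top-digit zc zd same
... | inj₁ i<m  = zeckendorf-digits zc zd m lower i i<m
  where
  lower : value c m ≡ value d m
  lower = ℕ.+-cancelʳ-≡ (c m ℕ.* fib m) (value c m) (value d m)
    (trans same (cong (λ v → value d m ℕ.+ v ℕ.* fib m) (sym (top-digit zc zd same))))

indicator : ℤ → ℕ → ℕ
indicator z i with z ℤ.≟ + i
... | yes _ = 1
... | no  _ = 0

indicator-hit : ∀ i → indicator (+ i) i ≡ 1
indicator-hit i with + i ℤ.≟ + i
... | yes _  = refl
... | no i≢i = ⊥-elim (i≢i refl)

indicator-miss : ∀ {z i} → z ≢ + i → indicator z i ≡ 0
indicator-miss {z} {i} z≢i with z ℤ.≟ + i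
... | yes z≡i = ⊥-elim (z≢i z≡i)
... | no  _   = refl

value-indicator : ∀ z B → ∣ z ∣ ℕ.< B → value (indicator z) B ≡ f z
value-indicator -[1+ n ] B _ = value-vanishing B (λ _ _ → refl)
value-indicator (+ j) (suc m) j<1+m with ℕ.m≤n⇒m<n∨m≡n (ℕ.s≤s⁻¹ j<1+m)
... | inj₁ j<m = trans (value-digit0 (indicator (+ j)) m (indicator-miss j≢m))
                       (value-indicator (+ j) m j<m)
  where
  j≢m : + j ≢ + m
  j≢m j≡m = ℕ.<-irrefl (ℤ.+-injective j≡m) j<m
... | inj₂ refl = begin
  value (indicator (+ j)) (suc j)          ≡⟨ value-digit1 (indicator (+ j)) j (indicator-hit j) ⟩
  value (indicator (+ j)) j ℕ.+ fib j      ≡⟨ cong (ℕ._+ fib j) (value-vanishing j below) ⟩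
  fib j                                    ∎
  where
  open ≡-Reasoning
  below : ∀ i → i ℕ.< j → indicator (+ j) i ≡ 0
  below i i<j = indicator-miss (λ j≡i → ℕ.<-irrefl (sym (ℤ.+-injective j≡i)) i<j)

mult : List ℤ → ℕ → ℕ
mult L i = sum (map (λ z → indicator z i) L)

sum-f-value : ∀ L B → (∀ {z} → z ∈ L → ∣ z ∣ ℕ.< B) → sum (map f L) ≡ value (mult L) B
sum-f-value []      B _       = sym (value-vanishing B (λ _ _ → refl))
sum-f-value (z ∷ L) B bounded = begin
  f z ℕ.+ sum (map f L)                          ≡⟨ cong₂ ℕ._+_ (sym (value-indicator z B (bounded (here refl))))
                                                                (sum-f-value L B (bounded ∘ there)) ⟩
  value (indicator z) B ℕ.+ value (mult L) B     ≡⟨ sym (value-+ (indicator z) (mult L) B) ⟩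
  value (mult (z ∷ L)) B                         ∎
  where
  open ≡-Reasoning

mult-∉ : ∀ {L i} → + i ∉ L → mult L i ≡ 0
mult-∉ {[]}    _   = refl
mult-∉ {z ∷ L} {i} i∉ = cong₂ ℕ._+_ (indicator-miss (λ z≡i → i∉ (here (sym z≡i))))
                                     (mult-∉ (λ i∈L → i∉ (there i∈L)))

mult-∈ : ∀ {L i} → Unique L → + i ∈ L → mult L i ≡ 1
mult-∈ {i = i} (z≢L ∷ _) (here refl) =
  cong₂ ℕ._+_ (indicator-hit i) (mult-∉ (λ i∈L → All.lookup z≢L i∈L refl))
mult-∈ (z≢L ∷ uL) (there i∈L) =
  cong₂ ℕ._+_ (indicator-miss (All.lookup z≢L i∈L)) (mult-∈ uL i∈L)

mult≡1⇒∈ : ∀ {L i} → mult L i ≡ 1 → + i ∈ L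
mult≡1⇒∈ {z ∷ L} {i} once with z ℤ.≟ + i
... | yes z≡i = here (sym z≡i)
... | no  _   = there (mult≡1⇒∈ once)

small-absent : ∀ {L i} → (∀ {z} → z ∈ L → + 1 < z) → i ℕ.≤ 1 → + i ∉ L
small-absent above i≤1 i∈L = ℕ.<⇒≱ (ℤ.drop‿+<+ (above i∈L)) i≤1

mult-zeckendorf : ∀ {L} → Unique L → Holey L → (∀ {z} → z ∈ L → + 1 < z) → Zeckendorf (mult L)
mult-zeckendorf {L} unique holey above = record
  { binary   = binary′
  ; digit₀   = mult-∉ (small-absent above z≤n)
  ; digit₁   = mult-∉ (small-absent above (s≤s z≤n))
  ; isolated = λ i once → mult-∉ (next-absent i (mult≡1⇒∈ once))
  }
  where
  binary′ : ∀ i → mult L i ≡ 0 ⊎ mult L i ≡ 1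
  binary′ i with + i ∈? L
  ... | yes i∈L = inj₂ (mult-∈ unique i∈L)
  ... | no  i∉L = inj₁ (mult-∉ i∉L)
  next-absent : ∀ i → + i ∈ L → + suc i ∉ L
  next-absent i i∈L = subst (_∉ L) (cong +_ (ℕ.+-comm i 1)) (holey (+ i) i∈L)

∈⇒≤sum : ∀ {n ns} → n ∈ ns → n ℕ.≤ sum ns
∈⇒≤sum {ns = n ∷ ns}  (here refl) = ℕ.m≤m+n n (sum ns)
∈⇒≤sum {ns = m ∷ ns} (there n∈)  = ℕ.≤-trans (∈⇒≤sum n∈) (ℕ.m≤n+m (sum ns) m)

zeckendorf-unique : ∀ {L L′} →
  Unique L  → Holey L  → (∀ {z} → z ∈ L  → + 1 < z) →
  Unique L′ → Holey L′ → (∀ {z} → z ∈ L′ → + 1 < z) →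
  sum (map f L) ≡ sum (map f L′) → ∀ {z} → z ∈ L → z ∈ L′
zeckendorf-unique _ _ above _ _ _ _ { -[1+ n ]} z∈L with above z∈L
... | ()
zeckendorf-unique {L} {L′} u h above u′ h′ above′ sums {+ j} z∈L =
  mult≡1⇒∈ (trans (sym (same-digits j (bounded z∈L))) (mult-∈ u z∈L))
  where
  B : ℕ
  B = suc (sum (map ∣_∣ L) ℕ.+ sum (map ∣_∣ L′))
  bounded : ∀ {y} → y ∈ L → ∣ y ∣ ℕ.< B
  bounded y∈ = s≤s (ℕ.≤-trans (∈⇒≤sum (∈-map⁺ ∣_∣ y∈)) (ℕ.m≤m+n _ _))
  bounded′ : ∀ {y} → y ∈ L′ → ∣ y ∣ ℕ.< B
  bounded′ y∈ = s≤s (ℕ.≤-trans (∈⇒≤sum (∈-map⁺ ∣_∣ y∈)) (ℕ.m≤n+m _ _))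
  same-digits : ∀ i → i ℕ.< B → mult L i ≡ mult L′ i
  same-digits = zeckendorf-digits (mult-zeckendorf u h above) (mult-zeckendorf u′ h′ above′) B
    (trans (sym (sum-f-value L B bounded)) (trans sums (sum-f-value L′ B bounded′)))

translate : ℤ → List ℤ → List ℤ
translate N = map (_+_ N)

translate-unique : ∀ N {S} → Unique S → Unique (translate N S)
translate-unique N = Unique.map⁺ (+-cancelˡ N _ _)

translate-holey : ∀ N {S} → Holey S → Holey (translate N S)
translate-holey N {S} holey z z∈ z+1∈ with ∈-map⁻ (_+_ N) z∈ | ∈-map⁻ (_+_ N) z+1∈
... | s , s∈S , refl | s′ , s′∈S , N+s+1≡N+s′ =
  holey s s∈S (subst (_∈ S) s′≡s+1 s′∈S)
  where
  s′≡s+1 : s′ ≡ s + + 1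
  s′≡s+1 = +-cancelˡ N s′ (s + + 1) (trans (sym N+s+1≡N+s′) (ℤ.+-assoc N s (+ 1)))

translate-reflects : ∀ N {S x} → N + x ∈ translate N S → x ∈ S
translate-reflects N {S} N+x∈ with ∈-map⁻ (_+_ N) N+x∈
... | s , s∈S , N+x≡N+s = subst (_∈ S) (sym (+-cancelˡ N _ _ N+x≡N+s)) s∈S

translated-zeckendorf : ∀ N {S S′} →
  Unique S  → Holey S  → (∀ {s} → s ∈ S  → + 1 < N + s) →
  Unique S′ → Holey S′ → (∀ {s} → s ∈ S′ → + 1 < N + s) →
  sum (map (λ s → f (N + s)) S) ≡ sum (map (λ s → f (N + s)) S′) →
  ∀ {x} → x ∈ S → x ∈ S′
translated-zeckendorf N {S} {S′} u h above u′ h′ above′ sums x∈S =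
  translate-reflects N (zeckendorf-unique
    (translate-unique N u)  (translate-holey N h)  (translated-above above)
    (translate-unique N u′) (translate-holey N h′) (translated-above above′)
    translated-sums (∈-map⁺ (_+_ N) x∈S))
  where
  translated-above : ∀ {T} → (∀ {s} → s ∈ T → + 1 < N + s) → ∀ {z} → z ∈ translate N T → + 1 < z
  translated-above above-T z∈ with ∈-map⁻ (_+_ N) z∈
  ... | _ , s∈T , refl = above-T s∈T
  translated-sums : sum (map f (translate N S)) ≡ sum (map f (translate N S′))
  translated-sums = begin
    sum (map f (translate N S))       ≡⟨ cong sum (map-∘ S) ⟨
    sum (map (λ s → f (N + s)) S)     ≡⟨ sums ⟩
    sum (map (λ s → f (N + s)) S′)    ≡⟨ cong sum (map-∘ S′) ⟩
    sum (map f (translate N S′))      ∎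
    where open ≡-Reasoning

translate-above-one : ∀ b z → ∣ z ∣ ℕ.≤ b → + 1 < + (2 ℕ.+ b) + z
translate-above-one b (+ m)    _   = +<+ (s≤s (s≤s z≤n))
translate-above-one b -[1+ m ] m<b rewrite ℤ.⊖-≥ (ℕ.≤-trans m<b (ℕ.m≤n+m b 2)) =
  +<+ (ℕ.m+n≤o⇒m≤o∸n 2 (ℕ.+-monoʳ-≤ 2 m<b))

lemma9 : (k : ℕ) (a : Fin k → ℤ) (S S′ : List ℤ) →
    Unique S → Holey S → Unique S′ → Holey S′ →
    (∀ (n : ℤ) → (∀ t → + 0 < n + a t) → (∀ s → s ∈ S → + 0 < n + s) →
      sum (map (λ t → f (n + a t)) (allFin k)) ≡ sum (map (λ s → f (n + s)) S)) →
    (∀ (n : ℤ) → (∀ t → + 0 < n + a t) → (∀ s → s ∈ S′ → + 0 < n + s) →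
      sum (map (λ t → f (n + a t)) (allFin k)) ≡ sum (map (λ s → f (n + s)) S′)) →
    ∀ x → (x ∈ S ⇔ x ∈ S′)
lemma9 k a S S′ uS hS uS′ hS′ sumsS sumsS′ x =
  mk⇔ (translated-zeckendorf N uS hS aboveS uS′ hS′ aboveS′ sums)
      (translated-zeckendorf N uS′ hS′ aboveS′ uS hS aboveS (sym sums))
  where
  indices : List ℤ
  indices = map a (allFin k) ++ S ++ S′
  N : ℤ
  N = + (2 ℕ.+ sum (map ∣_∣ indices))
  above : ∀ {z} → z ∈ indices → + 1 < N + z
  above {z} z∈ = translate-above-one _ z (∈⇒≤sum (∈-map⁺ ∣_∣ z∈))
  positive : ∀ {z} → z ∈ indices → + 0 < N + z
  positive z∈ = ℤ.<-trans (+<+ (s≤s z≤n)) (above z∈)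
  a∈ : ∀ t → a t ∈ indices
  a∈ t = ∈-++⁺ˡ (∈-map⁺ a (∈-allFin t))
  S∈ : ∀ {s} → s ∈ S → s ∈ indices
  S∈ s∈ = ∈-++⁺ʳ (map a (allFin k)) (∈-++⁺ˡ s∈)
  S′∈ : ∀ {s} → s ∈ S′ → s ∈ indices
  S′∈ s∈ = ∈-++⁺ʳ (map a (allFin k)) (∈-++⁺ʳ S s∈)
  aboveS : ∀ {s} → s ∈ S → + 1 < N + s
  aboveS = above ∘ S∈
  aboveS′ : ∀ {s} → s ∈ S′ → + 1 < N + s
  aboveS′ = above ∘ S′∈
  sums : sum (map (λ s → f (N + s)) S) ≡ sum (map (λ s → f (N + s)) S′)
  sums = trans (sym (sumsS N (positive ∘ a∈) (λ _ → positive ∘ S∈)))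
               (sumsS′ N (positive ∘ a∈) (λ _ → positive ∘ S′∈))
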